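{- Let $G$ be a graph, $D_s, D_t$ multisets of vertices of $G$ of the same size, $M^*$ a minimum-cost matching between $D_s$ and $D_t$, $(u,g)\in M^*$, and $v$ a vertex that follows $u$ on a shortest path from $u$ to $g$ (so $\{u,v\}\in E(G)$ and $d_G(v,g)=d_G(u,g)-1$). Let $M = (M^*\setminus\{(u,g)\})\cup\{(v,g)\}$. Then $M$ is a minimum-cost matching between $(D_s\setminus\{u\})\cup\{v\}$ and $D_t$, and $c^*(D_s,D_t) = c^*((D_s\setminus\{u\})\cup\{v\}, D_t) + 1$.
   Context: A multiset of vertices is a function $V(G)\to\mathbb{N}\cup\{0\}$; set operations are pointwise: $H\setminus I=\max(H-I,0)$, $H\cup I = H+I$. A matching between multisets $D_s,D_t$ of equal size is a multiset $M$ of ordered vertex pairs such that each $v$ is the first coordinate of exactly $D_s(v)$ pairs and the second coordinate of exactly $D_t(v)$ pairs, counted with multiplicity. Its cost is $c(M)=\sum_{(u,v)} d_G(u,v)\cdot M(u,v)$, $d_G$ the shortest-path distance; $c^*(D_s,D_t)$ denotes the minimum cost of a matching between $D_s$ and $D_t$, and a minimum-cost matching is one attaining it. -}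

module Defs where

open import Data.Nat using (ℕ; zero; suc; _+_; _*_; _∸_; _≤_)
open import Data.Fin using (Fin; zero; suc; _≟_)
open import Data.Bool using (if_then_else_)
open import Data.Product using (_×_; Σ)
open import Relation.Nullary using (¬_)
open import Relation.Nullary.Decidable using (⌊_⌋)
open import Relation.Binary.PropositionalEquality using (_≡_)

record Graph (n : ℕ) : Set₁ where
  field
    Adj     : Fin n → Fin n → Set
    sym     : ∀ {u v} → Adj u v → Adj v u
    irrefl  : ∀ {u} → ¬ Adj u u
open Graph public

data Walk {n : ℕ} (G : Graph n) : Fin n → Fin n → ℕ → Set where
  [] : ∀ {u} → Walk G u u 0
  _∷_ : ∀ {u v w k} → Adj G u v → Walk G v w k → Walk G u w (suc k)

IsShortestPathDistance : ∀ {n} → Graph n → (Fin n → Fin n → ℕ) → Set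
IsShortestPathDistance G d =
  ∀ u v → Walk G u v (d u v) × (∀ k → Walk G u v k → d u v ≤ k)

∑ : ∀ {n} → (Fin n → ℕ) → ℕ
∑ {zero}  f = 0
∑ {suc n} f = f zero + ∑ (λ i → f (suc i))

Multiset : ℕ → Set
Multiset n = Fin n → ℕ

PairMultiset : ℕ → Set
PairMultiset n = Fin n → Fin n → ℕ

size : ∀ {n} → Multiset n → ℕ
size D = ∑ D

⟦_⟧ : ∀ {n} → Fin n → Multiset n
⟦ u ⟧ x = if ⌊ u ≟ x ⌋ then 1 else 0

⟦_,_⟧ : ∀ {n} → Fin n → Fin n → PairMultiset n
⟦ u , g ⟧ x y = if ⌊ u ≟ x ⌋ then (if ⌊ g ≟ y ⌋ then 1 else 0) else 0

_∖_ : ∀ {n} → Multiset n → Multiset n → Multiset n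
(H ∖ I) x = H x ∸ I x

_∪_ : ∀ {n} → Multiset n → Multiset n → Multiset n
(H ∪ I) x = H x + I x

_∖ₚ_ : ∀ {n} → PairMultiset n → PairMultiset n → PairMultiset n
(H ∖ₚ I) x y = H x y ∸ I x y

_∪ₚ_ : ∀ {n} → PairMultiset n → PairMultiset n → PairMultiset n
(H ∪ₚ I) x y = H x y + I x y

IsMatching : ∀ {n} → Multiset n → Multiset n → PairMultiset n → Set
IsMatching Ds Dt M =
  (∀ v → ∑ (λ w → M v w) ≡ Ds v) × (∀ v → ∑ (λ w → M w v) ≡ Dt v)

cost : ∀ {n} → (Fin n → Fin n → ℕ) → PairMultiset n → ℕ
cost d M = ∑ (λ u → ∑ (λ v → d u v * M u v))

IsMinCostMatching : ∀ {n} → (Fin n → Fin n → ℕ) →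
  Multiset n → Multiset n → PairMultiset n → Set
IsMinCostMatching d Ds Dt M =
  IsMatching Ds Dt M × (∀ M′ → IsMatching Ds Dt M′ → cost d M ≤ cost d M′)

IsMinCost : ∀ {n} → (Fin n → Fin n → ℕ) → Multiset n → Multiset n → ℕ → Set
IsMinCost d Ds Dt c =
  (Σ (PairMultiset _) λ M → IsMatching Ds Dt M × cost d M ≡ c)
  × (∀ M′ → IsMatching Ds Dt M′ → c ≤ cost d M′)

-- Rerouting the pair (u , g) of M* to (v , g) is again a matching, and since v
-- lies on a shortest u–g path it is cheaper by exactly one. Conversely, any
-- matching M′ from the new source multiset uses v as a source at least once, say
-- in (v , h); rerouting that pair back to (u , h) yields a matching from Ds that
-- costs at most one more, because d u h ≤ 1 + d v h along the edge uv. Comparing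
-- with the optimality of M* shows that the rerouted matching is optimal, and the
-- two minimum costs differ by one.
module Submission where

open import Defs hiding (sym)
open import Data.Nat using (ℕ; zero; suc; _+_; _*_; _∸_; _≤_; z≤n; s≤s)
open import Data.Nat.Properties hiding (_≟_)
open import Data.Fin using (Fin; zero; suc; _≟_)
open import Data.Bool using (true; false; if_then_else_)
open import Data.Empty using (⊥-elim)
-- The pair constructor is renamed because _,_ makes ⟦ a , b ⟧ ambiguous.
open import Data.Product using (_×_; proj₁; proj₂; Σ-syntax) renaming (_,_ to _▸_)
open import Function using (_∘_)
open import Relation.Nullary using (yes; no)
open import Relation.Nullary.Decidable using (⌊_⌋)
open import Relation.Binary.PropositionalEquality
open import Algebra.Properties.CommutativeSemigroup +-commutativeSemigroup
  using (interchange; xy∙z≈xz∙y; x∙yz≈xz∙y)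

∑-cong : ∀ {n} {f g : Fin n → ℕ} → f ≗ g → ∑ f ≡ ∑ g
∑-cong {zero}  f≗g = refl
∑-cong {suc n} f≗g = cong₂ _+_ (f≗g zero) (∑-cong (f≗g ∘ suc))

∑-+ : ∀ {n} (f g : Fin n → ℕ) → ∑ (λ x → f x + g x) ≡ ∑ f + ∑ g
∑-+ {zero}  f g = refl
∑-+ {suc n} f g = trans (cong (f zero + g zero +_) (∑-+ (f ∘ suc) (g ∘ suc)))
                        (interchange (f zero) (g zero) (∑ (f ∘ suc)) (∑ (g ∘ suc)))

∑-zero : ∀ {n} → ∑ {n} (λ _ → 0) ≡ 0
∑-zero {zero}  = refl
∑-zero {suc n} = ∑-zero {n}

∑-if : ∀ {n} c (f : Fin n → ℕ) → ∑ (λ x → if c then f x else 0) ≡ (if c then ∑ f else 0)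
∑-if true  f = refl
∑-if {n} false f = ∑-zero {n}

⌊suc≟suc⌋ : ∀ {n} (a x : Fin n) → ⌊ suc a ≟ suc x ⌋ ≡ ⌊ a ≟ x ⌋
⌊suc≟suc⌋ a x with a ≟ x
... | yes _ = refl
... | no  _ = refl

∑-select : ∀ {n} (a : Fin n) (f : Fin n → ℕ) →
  ∑ (λ x → if ⌊ a ≟ x ⌋ then f x else 0) ≡ f a
∑-select {suc n} zero    f = trans (cong (f zero +_) (∑-zero {n})) (+-identityʳ (f zero))
∑-select {suc n} (suc a) f =
  trans (∑-cong (λ x → cong (λ b → if b then f (suc x) else 0) (⌊suc≟suc⌋ a x)))
        (∑-select a (f ∘ suc))

≤-∑ : ∀ {n} (f : Fin n → ℕ) a → f a ≤ ∑ f
≤-∑ f zero    = m≤m+n (f zero) _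
≤-∑ f (suc a) = ≤-trans (≤-∑ (f ∘ suc) a) (m≤n+m _ (f zero))

∑-positive : ∀ {n} (f : Fin n → ℕ) → 1 ≤ ∑ f → Σ[ a ∈ Fin n ] 1 ≤ f a
∑-positive {suc n} f 1≤∑ with f zero in eq
... | suc _ = zero ▸ subst (1 ≤_) (sym eq) (s≤s z≤n)
... | zero  with ∑-positive (f ∘ suc) 1≤∑
...   | a ▸ 1≤fa = suc a ▸ 1≤fa

⟦⟧-self : ∀ {n} (a : Fin n) → ⟦ a ⟧ a ≡ 1
⟦⟧-self a with a ≟ a
... | yes _  = refl
... | no a≢a = ⊥-elim (a≢a refl)

⟦⟧-≤ : ∀ {n} (D : Multiset n) a → 1 ≤ D a → ∀ x → ⟦ a ⟧ x ≤ D x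
⟦⟧-≤ D a 1≤Da x with a ≟ x
... | yes refl = 1≤Da
... | no  _    = z≤n

⟦,⟧-≤ : ∀ {n} (M : PairMultiset n) a b → 1 ≤ M a b → ∀ x y → ⟦ a , b ⟧ x y ≤ M x y
⟦,⟧-≤ M a b 1≤Mab x y with a ≟ x | b ≟ y
... | yes refl | yes refl = 1≤Mab
... | yes refl | no  _    = z≤n
... | no  _    | _        = z≤n

∖-∪-cancel : ∀ {n} {H I : Multiset n} → (∀ x → I x ≤ H x) → (H ∖ I) ∪ I ≗ H
∖-∪-cancel I≤H x = m∸n+n≡m (I≤H x)

∪-∖-cancel : ∀ {n} (H I : Multiset n) → (H ∪ I) ∖ I ≗ H
∪-∖-cancel H I x = m+n∸n≡m (H x) (I x)

∪-⟦⟧-self : ∀ {n} (D : Multiset n) a → 1 ≤ (D ∪ ⟦ a ⟧) a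
∪-⟦⟧-self D a = subst (λ k → 1 ≤ D a + k) (sym (⟦⟧-self a)) (m≤n+m 1 (D a))

IsMatching-resp : ∀ {n} {D D′ E E′ : Multiset n} {M M′ : PairMultiset n} →
  D ≗ D′ → E ≗ E′ → (∀ x y → M x y ≡ M′ x y) →
  IsMatching D E M → IsMatching D′ E′ M′
IsMatching-resp D≗D′ E≗E′ M≗M′ (rows ▸ cols) =
  (λ x → trans (sym (∑-cong (M≗M′ x))) (trans (rows x) (D≗D′ x))) ▸
  (λ y → trans (sym (∑-cong (λ x → M≗M′ x y))) (trans (cols y) (E≗E′ y)))

IsMatching-∪ : ∀ {n} {D₁ D₂ E₁ E₂ : Multiset n} {A B : PairMultiset n} →
  IsMatching D₁ E₁ A → IsMatching D₂ E₂ B → IsMatching (D₁ ∪ D₂) (E₁ ∪ E₂) (A ∪ₚ B)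
IsMatching-∪ {A = A} {B} (rowsA ▸ colsA) (rowsB ▸ colsB) =
  (λ x → trans (∑-+ (A x) (B x)) (cong₂ _+_ (rowsA x) (rowsB x))) ▸
  (λ y → trans (∑-+ (λ x → A x y) (λ x → B x y)) (cong₂ _+_ (colsA y) (colsB y)))

IsMatching-∖ : ∀ {n} {D D₂ E E₂ : Multiset n} {A B : PairMultiset n} →
  IsMatching D E (A ∪ₚ B) → IsMatching D₂ E₂ B → IsMatching (D ∖ D₂) (E ∖ E₂) A
IsMatching-∖ {A = A} {B} (rows ▸ cols) (rowsB ▸ colsB) =
  (λ x → subtract (A x) (B x) (rows x) (rowsB x)) ▸
  (λ y → subtract (λ x → A x y) (λ x → B x y) (cols y) (colsB y))
  where
  subtract : ∀ {n} (f g : Fin n → ℕ) {s t} →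
    ∑ (λ x → f x + g x) ≡ s → ∑ g ≡ t → ∑ f ≡ s ∸ t
  subtract f g refl refl =
    trans (sym (m+n∸n≡m (∑ f) (∑ g))) (cong (_∸ ∑ g) (sym (∑-+ f g)))

IsMatching-⟦,⟧ : ∀ {n} (a b : Fin n) → IsMatching ⟦ a ⟧ ⟦ b ⟧ ⟦ a , b ⟧
IsMatching-⟦,⟧ a b =
  (λ x → trans (∑-if ⌊ a ≟ x ⌋ ⟦ b ⟧) (cong (λ s → if ⌊ a ≟ x ⌋ then s else 0) (∑-select b (λ _ → 1)))) ▸
  (λ y → ∑-select a (λ _ → ⟦ b ⟧ y))

entry≤source : ∀ {n} {D E : Multiset n} {M : PairMultiset n} →
  IsMatching D E M → ∀ a b → M a b ≤ D a
entry≤source {M = M} (rows ▸ _) a b = subst (M a b ≤_) (rows a) (≤-∑ (M a) b)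

entry≤target : ∀ {n} {D E : Multiset n} {M : PairMultiset n} →
  IsMatching D E M → ∀ a b → M a b ≤ E b
entry≤target {M = M} (_ ▸ cols) a b = subst (M a b ≤_) (cols b) (≤-∑ (λ x → M x b) a)

cost-cong : ∀ {n} (d : Fin n → Fin n → ℕ) {M M′ : PairMultiset n} →
  (∀ x y → M x y ≡ M′ x y) → cost d M ≡ cost d M′
cost-cong d M≗M′ = ∑-cong (λ x → ∑-cong (λ y → cong (d x y *_) (M≗M′ x y)))

cost-∪ₚ : ∀ {n} (d : Fin n → Fin n → ℕ) (A B : PairMultiset n) →
  cost d (A ∪ₚ B) ≡ cost d A + cost d B
cost-∪ₚ d A B = begin
  ∑ (λ x → ∑ (λ y → d x y * (A x y + B x y)))
    ≡⟨ ∑-cong (λ x → ∑-cong (λ y → *-distribˡ-+ (d x y) (A x y) (B x y))) ⟩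
  ∑ (λ x → ∑ (λ y → d x y * A x y + d x y * B x y))
    ≡⟨ ∑-cong (λ x → ∑-+ (λ y → d x y * A x y) (λ y → d x y * B x y)) ⟩
  ∑ (λ x → ∑ (λ y → d x y * A x y) + ∑ (λ y → d x y * B x y))
    ≡⟨ ∑-+ (λ x → ∑ (λ y → d x y * A x y)) (λ x → ∑ (λ y → d x y * B x y)) ⟩
  cost d A + cost d B ∎
  where open ≡-Reasoning

cost-⟦,⟧ : ∀ {n} (d : Fin n → Fin n → ℕ) (a b : Fin n) → cost d ⟦ a , b ⟧ ≡ d a b
cost-⟦,⟧ d a b = trans (∑-cong row) (∑-select a (λ x → d x b))
  where
  *-if : ∀ k c₁ c₂ → k * (if c₁ then (if c₂ then 1 else 0) else 0) ≡ (if c₁ then (if c₂ then k else 0) else 0)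
  *-if k true  true  = *-identityʳ k
  *-if k true  false = *-zeroʳ k
  *-if k false _     = *-zeroʳ k
  row : ∀ x → ∑ (λ y → d x y * ⟦ a , b ⟧ x y) ≡ (if ⌊ a ≟ x ⌋ then d x b else 0)
  row x = trans (∑-cong (λ y → *-if (d x y) ⌊ a ≟ x ⌋ ⌊ b ≟ y ⌋))
         (trans (∑-if ⌊ a ≟ x ⌋ (λ y → if ⌊ b ≟ y ⌋ then d x y else 0))
                (cong (λ s → if ⌊ a ≟ x ⌋ then s else 0) (∑-select b (d x))))

cost-∪ₚ-⟦,⟧ : ∀ {n} (d : Fin n → Fin n → ℕ) (A : PairMultiset n) a b →
  cost d (A ∪ₚ ⟦ a , b ⟧) ≡ cost d A + d a b
cost-∪ₚ-⟦,⟧ d A a b = trans (cost-∪ₚ d A ⟦ a , b ⟧) (cong (cost d A +_) (cost-⟦,⟧ d a b))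

reroute : ∀ {n} → PairMultiset n → Fin n → Fin n → Fin n → PairMultiset n
reroute M a b c = (M ∖ₚ ⟦ a , b ⟧) ∪ₚ ⟦ c , b ⟧

∖ₚ-∪ₚ-cancel : ∀ {n} (M : PairMultiset n) a b → 1 ≤ M a b →
  ∀ x y → ((M ∖ₚ ⟦ a , b ⟧) ∪ₚ ⟦ a , b ⟧) x y ≡ M x y
∖ₚ-∪ₚ-cancel M a b 1≤Mab x y = m∸n+n≡m (⟦,⟧-≤ M a b 1≤Mab x y)

reroute-IsMatching : ∀ {n} {D E : Multiset n} {M : PairMultiset n} {a b} →
  IsMatching D E M → 1 ≤ M a b → ∀ c →
  IsMatching ((D ∖ ⟦ a ⟧) ∪ ⟦ c ⟧) E (reroute M a b c)
reroute-IsMatching {E = E} {M} {a} {b} m 1≤Mab c =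
  IsMatching-resp (λ _ → refl) (∖-∪-cancel (⟦⟧-≤ E b 1≤Eb)) (λ _ _ → refl)
    (IsMatching-∪ (IsMatching-∖ m′ (IsMatching-⟦,⟧ a b)) (IsMatching-⟦,⟧ c b))
  where
  1≤Eb = ≤-trans 1≤Mab (entry≤target m a b)
  m′ = IsMatching-resp (λ _ → refl) (λ _ → refl) (λ x y → sym (∖ₚ-∪ₚ-cancel M a b 1≤Mab x y)) m

reroute-cost : ∀ {n} (d : Fin n → Fin n → ℕ) {M : PairMultiset n} {a b} →
  1 ≤ M a b → ∀ c → cost d M + d c b ≡ cost d (reroute M a b c) + d a b
reroute-cost d {M} {a} {b} 1≤Mab c = begin
  cost d M + d c b
    ≡⟨ cong (_+ d c b) (trans (cost-cong d (λ x y → sym (∖ₚ-∪ₚ-cancel M a b 1≤Mab x y)))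
                              (cost-∪ₚ-⟦,⟧ d A a b)) ⟩
  cost d A + d a b + d c b
    ≡⟨ xy∙z≈xz∙y (cost d A) (d a b) (d c b) ⟩
  cost d A + d c b + d a b
    ≡⟨ cong (_+ d a b) (sym (cost-∪ₚ-⟦,⟧ d A c b)) ⟩
  cost d (reroute M a b c) + d a b ∎
  where
  open ≡-Reasoning
  A = M ∖ₚ ⟦ a , b ⟧

adjacent-distance : ∀ {n} {G : Graph n} {d : Fin n → Fin n → ℕ} →
  IsShortestPathDistance G d → ∀ {u v} → Adj G u v → ∀ h → d u h ≤ suc (d v h)
adjacent-distance sp {u} {v} uv h = proj₂ (sp u h) _ (uv ∷ proj₁ (sp v h))

move-source : ∀ {n} (d : Fin n → Fin n → ℕ) {u v : Fin n} → (∀ h → d u h ≤ suc (d v h)) →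
  ∀ {D E : Multiset n} {M : PairMultiset n} → IsMatching D E M → 1 ≤ D v →
  Σ[ M′ ∈ PairMultiset n ] IsMatching ((D ∖ ⟦ v ⟧) ∪ ⟦ u ⟧) E M′ × cost d M′ ≤ suc (cost d M)
move-source d {u} {v} d≤ {M = M} m 1≤Dv
  with ∑-positive (M v) (subst (1 ≤_) (sym (proj₁ m v)) 1≤Dv)
... | h ▸ 1≤Mvh = reroute M v h u ▸ reroute-IsMatching m 1≤Mvh u ▸ +-cancelʳ-≤ (d v h) _ _ (begin
  cost d (reroute M v h u) + d v h ≡⟨ reroute-cost d 1≤Mvh u ⟨
  cost d M + d u h                 ≤⟨ +-monoʳ-≤ (cost d M) (d≤ h) ⟩
  cost d M + suc (d v h)           ≡⟨ +-suc (cost d M) (d v h) ⟩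
  suc (cost d M) + d v h           ∎)
  where open ≤-Reasoning

min-cost≤moved-cost+1 : ∀ {n} (d : Fin n → Fin n → ℕ) {u v : Fin n} → (∀ h → d u h ≤ suc (d v h)) →
  ∀ {Ds Dt : Multiset n} {M* : PairMultiset n} → IsMinCostMatching d Ds Dt M* → 1 ≤ Ds u →
  ∀ M′ → IsMatching ((Ds ∖ ⟦ u ⟧) ∪ ⟦ v ⟧) Dt M′ → cost d M* ≤ suc (cost d M′)
min-cost≤moved-cost+1 d {u} {v} d≤ {Ds} (_ ▸ M*-minimal) 1≤Dsu M′ m′
  with move-source d d≤ m′ (∪-⟦⟧-self (Ds ∖ ⟦ u ⟧) v)
... | M″ ▸ m″ ▸ cost≤ = ≤-trans (M*-minimal M″ (IsMatching-resp restore (λ _ → refl) (λ _ _ → refl) m″)) cost≤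
  where
  restore : (((Ds ∖ ⟦ u ⟧) ∪ ⟦ v ⟧) ∖ ⟦ v ⟧) ∪ ⟦ u ⟧ ≗ Ds
  restore x = trans (cong (_+ ⟦ u ⟧ x) (∪-∖-cancel (Ds ∖ ⟦ u ⟧) ⟦ v ⟧ x)) (∖-∪-cancel (⟦⟧-≤ Ds u 1≤Dsu) x)

IsMinCost-cost : ∀ {n} (d : Fin n → Fin n → ℕ) {D E : Multiset n} {M : PairMultiset n} {c} →
  IsMinCostMatching d D E M → IsMinCost d D E c → c ≡ cost d M
IsMinCost-cost d (m ▸ minimal) ((W ▸ w ▸ refl) ▸ c≤) = ≤-antisym (c≤ _ m) (minimal W w)

lemma3 : ∀ {n} (G : Graph n) (d : Fin n → Fin n → ℕ) →
    IsShortestPathDistance G d →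
    (Ds Dt : Multiset n) → size Ds ≡ size Dt →
    (M* : PairMultiset n) → IsMinCostMatching d Ds Dt M* →
    (u g v : Fin n) → 1 ≤ M* u g →
    Adj G u v → d v g + 1 ≡ d u g →
    IsMinCostMatching d ((Ds ∖ ⟦ u ⟧) ∪ ⟦ v ⟧) Dt ((M* ∖ₚ ⟦ u , g ⟧) ∪ₚ ⟦ v , g ⟧)
    × (∀ c₁ c₂ → IsMinCost d Ds Dt c₁ → IsMinCost d ((Ds ∖ ⟦ u ⟧) ∪ ⟦ v ⟧) Dt c₂ →
         c₁ ≡ c₂ + 1)
lemma3 G d sp Ds Dt _ M* M*-opt@(M*-matching ▸ _) u g v 1≤M*ug uv dvg+1≡dug =
  M-opt ▸ λ c₁ c₂ c₁-min c₂-min →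
    trans (IsMinCost-cost d M*-opt c₁-min) (trans cost-drop (cong (_+ 1) (sym (IsMinCost-cost d M-opt c₂-min))))
  where
  M = reroute M* u g v
  cost-drop : cost d M* ≡ cost d M + 1
  cost-drop = +-cancelʳ-≡ (d v g) _ _ (begin
    cost d M* + d v g      ≡⟨ reroute-cost d 1≤M*ug v ⟩
    cost d M + d u g       ≡⟨ cong (cost d M +_) dvg+1≡dug ⟨
    cost d M + (d v g + 1) ≡⟨ x∙yz≈xz∙y (cost d M) (d v g) 1 ⟩
    cost d M + 1 + d v g   ∎)
    where open ≡-Reasoning
  M-minimal : ∀ M′ → IsMatching ((Ds ∖ ⟦ u ⟧) ∪ ⟦ v ⟧) Dt M′ → cost d M ≤ cost d M′
  M-minimal M′ m′ = +-cancelʳ-≤ 1 (cost d M) (cost d M′) (begin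
    cost d M + 1    ≡⟨ cost-drop ⟨
    cost d M*       ≤⟨ min-cost≤moved-cost+1 d (adjacent-distance sp uv) M*-opt
                         (≤-trans 1≤M*ug (entry≤source M*-matching u g)) M′ m′ ⟩
    suc (cost d M′) ≡⟨ +-comm 1 (cost d M′) ⟩
    cost d M′ + 1   ∎)
    where open ≤-Reasoning
  M-opt : IsMinCostMatching d ((Ds ∖ ⟦ u ⟧) ∪ ⟦ v ⟧) Dt M
  M-opt = reroute-IsMatching M*-matching 1≤M*ug v ▸ M-minimal
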